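{- Let $(G,\lambda)$ be an edge-labeled finite simple graph with $|V_G|\ge2$, and let $v\in V_G$ be an MAT-simplicial vertex of $(G,\lambda)$. Then $\lambda$ is an MAT-labeling of $G$ if and only if $\lambda|_{E_{G\setminus v}}$ is an MAT-labeling of the induced subgraph $G\setminus v=G[V_G\setminus\{v\}]$.
   Context: An edge-labeled graph is a simple graph $G$ with a map $\lambda:E_G\to\mathbb{Z}_{>0}$. MAT-labeling: put $\pi_k=\lambda^{ -1}(k)$, $E_k=\pi_1\sqcup\dots\sqcup\pi_k$, $E_0=\varnothing$; $\operatorname{cl}(F)$ is the set of edges whose endvertices are joined by a path of edges in $F$; $\lambda$ is an MAT-labeling if for all $k\ge1$: (ML1) $\pi_k$ is a forest; (ML2) $\operatorname{cl}(\pi_k)\cap E_{k-1}=\varnothing$; (ML3) each $\{u,w'\}\in\pi_k$ has exactly $k-1$ vertices $w$ with $\{u,w\},\{w',w\}\in E_{k-1}$. A vertex $v$ is MAT-simplicial in $(G,\lambda)$ if: (MS1) $N_G(v)$ is a clique; (MS2) $\{\lambda(\{u,v\})\mid u\in N_G(v)\}=\{1,\dots,\deg_G(v)\}$; (MS3) for distinct $u_1,u_2\in N_G(v)$, $\lambda(\{u_1,u_2\})<\max\{\lambda(\{u_1,v\}),\lambda(\{u_2,v\})\}$. -}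

module Defs where

open import Data.Nat using (ℕ; zero; suc; _≤_; _<_; _⊔_; _∸_; _≤ᵇ_)
open import Data.Bool using (Bool; true; false; _∧_; if_then_else_)
open import Data.Fin using (Fin; toℕ; punchIn; fromℕ)
open import Data.List using (List; length; filter; allFin)
open import Data.Product using (Σ; _×_; _,_; ∃-syntax)
open import Relation.Binary.PropositionalEquality using (_≡_; _≢_)
open import Relation.Nullary using (¬_)
open import Relation.Nullary.Decidable using (does)
open import Function.Definitions using (Injective)

-- The label of the edge {u,w} is  lab u w  (symmetric);
-- values of  lab  on non-edges are irrelevant.
record EdgeLabeledGraph (n : ℕ) : Set where
  field
    adj       : Fin n → Fin n → Bool
    adj-irr   : ∀ u → adj u u ≡ false
    adj-sym   : ∀ u w → adj u w ≡ adj w u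
    lab       : Fin n → Fin n → ℕ
    lab-sym   : ∀ u w → adj u w ≡ true → lab u w ≡ lab w u
    lab-pos   : ∀ u w → adj u w ≡ true → 1 ≤ lab u w

open EdgeLabeledGraph public

count : ∀ {n} → (Fin n → Bool) → ℕ
count {n} p = length (filter (λ x → Data.Bool._≟_ (p x) true) (allFin n))

module _ {n : ℕ} (G : EdgeLabeledGraph n) where

  inπ : ℕ → Fin n → Fin n → Set
  inπ k u w = adj G u w ≡ true × lab G u w ≡ k

  -- {u,w} ∈ E_k = π_1 ⊔ … ⊔ π_k  (labels are ≥ 1)
  inE : ℕ → Fin n → Fin n → Set
  inE k u w = adj G u w ≡ true × lab G u w ≤ k

  inEᵇ : ℕ → Fin n → Fin n → Bool
  inEᵇ k u w = adj G u w ∧ (lab G u w ≤ᵇ k)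

data Reach {n : ℕ} (F : Fin n → Fin n → Set) : Fin n → Fin n → Set where
  here : ∀ {x} → Reach F x x
  step : ∀ {x y z} → F x y → Reach F y z → Reach F x z

Cycle : ∀ {n} → (Fin n → Fin n → Set) → Set
Cycle {n} F =
  Σ ℕ λ m → Σ (Fin (suc (suc (suc m))) → Fin n) λ c →
    Injective _≡_ _≡_ c
    × (∀ i j → toℕ j ≡ suc (toℕ i) → F (c i) (c j))
    × F (c (fromℕ (suc (suc m)))) (c Data.Fin.zero)

IsForest : ∀ {n} → (Fin n → Fin n → Set) → Set
IsForest F = ¬ Cycle F

module _ {n : ℕ} (G : EdgeLabeledGraph n) where

  inCl : (Fin n → Fin n → Set) → Fin n → Fin n → Set
  inCl F x y = adj G x y ≡ true × Reach F x y

  ML1 : ℕ → Set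
  ML1 k = IsForest (inπ G k)

  ML2 : ℕ → Set
  ML2 k = ∀ x y → inCl (inπ G k) x y → ¬ inE G (k ∸ 1) x y

  ML3 : ℕ → Set
  ML3 k = ∀ u w' → inπ G k u w' →
    count (λ w → inEᵇ G (k ∸ 1) u w ∧ inEᵇ G (k ∸ 1) w' w) ≡ k ∸ 1

  IsMATLabeling : Set
  IsMATLabeling = ∀ k → 1 ≤ k → ML1 k × ML2 k × ML3 k

  degree : Fin n → ℕ
  degree v = count (λ u → adj G u v)

  MS1 : Fin n → Set
  MS1 v = ∀ u₁ u₂ → adj G u₁ v ≡ true → adj G u₂ v ≡ true → u₁ ≢ u₂ →
    adj G u₁ u₂ ≡ true

  MS2 : Fin n → Set
  MS2 v = (∀ u → adj G u v ≡ true → 1 ≤ lab G u v × lab G u v ≤ degree v)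
        × (∀ k → 1 ≤ k → k ≤ degree v → ∃[ u ] (adj G u v ≡ true × lab G u v ≡ k))

  MS3 : Fin n → Set
  MS3 v = ∀ u₁ u₂ → adj G u₁ v ≡ true → adj G u₂ v ≡ true → u₁ ≢ u₂ →
    lab G u₁ u₂ < lab G u₁ v ⊔ lab G u₂ v

  IsMATSimplicial : Fin n → Set
  IsMATSimplicial v = MS1 v × MS2 v × MS3 v

deleteVertex : ∀ {m} → EdgeLabeledGraph (suc m) → Fin (suc m) → EdgeLabeledGraph m
deleteVertex G v = record
  { adj     = λ i j → adj G (punchIn v i) (punchIn v j)
  ; adj-irr = λ i → adj-irr G (punchIn v i)
  ; adj-sym = λ i j → adj-sym G (punchIn v i) (punchIn v j)
  ; lab     = λ i j → lab G (punchIn v i) (punchIn v j)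
  ; lab-sym = λ i j → lab-sym G (punchIn v i) (punchIn v j)
  ; lab-pos = λ i j → lab-pos G (punchIn v i) (punchIn v j)
  }

{-# OPTIONS --safe #-}
-- The labels of the edges at the MAT-simplicial vertex v enumerate {1,…,deg v}
-- bijectively (MS2), so v has at most one π_k-neighbour and exactly k−1
-- neighbours in E_{k−1} for k ≤ deg v. Thus v is a leaf of every π_k, and
-- deleting it changes neither the cycles of π_k nor which other vertices π_k
-- connects. By MS1 and MS3 the π_k-neighbour z of v is joined by an edge of
-- E_{k−1} to every E_{k−1}-neighbour of v: this settles ML2 for edges at v
-- (a π_k-path from v continues from z), and ML3 for the π_k-edge {v,z}, whose
-- common E_{k−1}-neighbours are exactly the k−1 such neighbours of v. Finally
-- MS3 shows v is never a common E_{k−1}-neighbour of the ends of a π_k-edge, so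
-- the counts in ML3 agree in G and G ∖ v for the remaining edges.
module Submission where

open import Defs
open import Data.Nat using (ℕ; zero; suc; _+_; _∸_; _≤_; _<_; _⊔_; z≤n; s≤s)
open import Data.Nat.Properties hiding (_≟_)
open import Data.Bool using (Bool; true; false; _∧_; not) renaming (_≟_ to _≟ᵇ_)
open import Data.Bool.Properties using (T-≡; ¬-not; ∧-conicalˡ; ∧-conicalʳ; ∧-comm)
open import Data.Fin using (Fin; zero; suc; punchIn; punchOut; toℕ; fromℕ; inject₁; lower₁; _≟_)
open import Data.Fin.Properties
  using (punchIn-punchOut; punchIn-injective; punchInᵢ≢i; toℕ-inject₁; toℕ-lower₁; toℕ-injective; toℕ-fromℕ; any?)
open import Data.List using (length; filter; tabulate)
open import Data.Product using (_,_; ∃; ∃₂; _×_; proj₁; proj₂; map₂)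
open import Function.Bundles using (Equivalence; _⇔_; mk⇔)
open import Data.Empty using (⊥-elim)
open import Function using (_∘_)
open import Relation.Nullary using (¬_; yes; no)
open import Relation.Binary.PropositionalEquality

bool→ℕ : Bool → ℕ
bool→ℕ true  = 1
bool→ℕ false = 0

count-tabulate : ∀ {A : Set} {n} (p : A → Bool) (g : Fin n → A) →
  length (filter (λ x → p x ≟ᵇ true) (tabulate g)) ≡ count (p ∘ g)
count-tabulate {n = zero}  p g = refl
count-tabulate {n = suc n} p g with p (g zero)
... | true  = cong suc (trans (count-tabulate p (g ∘ suc)) (sym (count-tabulate (p ∘ g) suc)))
... | false = trans (count-tabulate p (g ∘ suc)) (sym (count-tabulate (p ∘ g) suc))

count-suc : ∀ {n} (p : Fin (suc n) → Bool) → count p ≡ bool→ℕ (p zero) + count (p ∘ suc)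
count-suc p with p zero
... | true  = cong suc (count-tabulate p suc)
... | false = count-tabulate p suc

count-cong : ∀ {n} {p q : Fin n → Bool} → p ≗ q → count p ≡ count q
count-cong {zero}          p≗q = refl
count-cong {suc n} {p} {q} p≗q = begin
  count p                                ≡⟨ count-suc p ⟩
  bool→ℕ (p zero) + count (p ∘ suc)      ≡⟨ cong₂ _+_ (cong bool→ℕ (p≗q zero)) (count-cong (p≗q ∘ suc)) ⟩
  bool→ℕ (q zero) + count (q ∘ suc)      ≡⟨ sym (count-suc q) ⟩
  count q                                ∎
  where open ≡-Reasoning

count-punchIn : ∀ {n} (v : Fin (suc n)) (p : Fin (suc n) → Bool) →
  count p ≡ bool→ℕ (p v) + count (p ∘ punchIn v)
count-punchIn zero p = count-suc p
count-punchIn {suc n} (suc v) p = begin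
  count p                                      ≡⟨ count-suc p ⟩
  b₀ + count (p ∘ suc)                         ≡⟨ cong (b₀ +_) (count-punchIn v (p ∘ suc)) ⟩
  b₀ + (bᵥ + rest)                             ≡⟨ sym (+-assoc b₀ bᵥ rest) ⟩
  b₀ + bᵥ + rest                               ≡⟨ cong (_+ rest) (+-comm b₀ bᵥ) ⟩
  bᵥ + b₀ + rest                               ≡⟨ +-assoc bᵥ b₀ rest ⟩
  bᵥ + (b₀ + rest)                             ≡⟨ cong (bᵥ +_) (sym (count-suc (p ∘ punchIn (suc v)))) ⟩
  bᵥ + count (p ∘ punchIn (suc v))             ∎
  where
  open ≡-Reasoning
  b₀ = bool→ℕ (p zero)
  bᵥ = bool→ℕ (p (suc v))
  rest = count (p ∘ suc ∘ punchIn v)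

count-all-false : ∀ {n} (p : Fin n → Bool) → (∀ x → p x ≡ false) → count p ≡ 0
count-all-false {zero}  p p≡false = refl
count-all-false {suc n} p p≡false rewrite count-suc p | p≡false zero =
  count-all-false (p ∘ suc) (p≡false ∘ suc)

1≤count : ∀ {n} (p : Fin n → Bool) {x} → p x ≡ true → 1 ≤ count p
1≤count {suc n} p {x} px rewrite count-punchIn x p | px = s≤s z≤n

2≤count : ∀ {n} (p : Fin n → Bool) {x y} → x ≢ y → p x ≡ true → p y ≡ true → 2 ≤ count p
2≤count {suc n} p {x} {y} x≢y px py rewrite count-punchIn x p | px =
  s≤s (1≤count (p ∘ punchIn x) (trans (cong p (punchIn-punchOut x≢y)) py))

count-split : ∀ {n} (q p : Fin n → Bool) →
  count q ≡ count (λ x → q x ∧ p x) + count (λ x → q x ∧ not (p x))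
count-split {zero} q p = refl
count-split {suc n} q p
  rewrite count-suc q | count-suc (λ x → q x ∧ p x) | count-suc (λ x → q x ∧ not (p x))
  with q zero | p zero | count-split (q ∘ suc) (p ∘ suc)
... | true  | true  | ih = cong suc ih
... | true  | false | ih = trans (cong suc ih) (sym (+-suc _ _))
... | false | _     | ih = ih

≡true-ext : ∀ {a b : Bool} → (a ≡ true → b ≡ true) → (b ≡ true → a ≡ true) → a ≡ b
≡true-ext {false} {false} _ _ = refl
≡true-ext {false} {true}  _ b⇒a = b⇒a refl
≡true-ext {true}          a⇒b _ = sym (a⇒b refl)

count-punchIn-false : ∀ {n} (v : Fin (suc n)) {p : Fin (suc n) → Bool} → p v ≡ false →
  count p ≡ count (p ∘ punchIn v)
count-punchIn-false v {p} pv≡false =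
  trans (count-punchIn v p) (cong (λ b → bool→ℕ b + count (p ∘ punchIn v)) pv≡false)

count-split-⊆ : ∀ {n} (q p : Fin n → Bool) → (∀ x → p x ≡ true → q x ≡ true) →
  count q ≡ count p + count (λ x → q x ∧ not (p x))
count-split-⊆ q p p⊆q =
  trans (count-split q p) (cong (_+ count (λ x → q x ∧ not (p x))) (count-cong q∧p≗p))
  where
  q∧p≗p : (λ x → q x ∧ p x) ≗ p
  q∧p≗p x = ≡true-ext (∧-conicalʳ (q x) (p x)) (λ px → cong₂ _∧_ (p⊆q x px) px)

module _ {f : ℕ → ℕ} {d : ℕ} (unit-step : ∀ j → j < d → suc (f j) ≤ f (suc j)) where

  f[i]+t≤f[i+t] : ∀ i t → i + t ≤ d → f i + t ≤ f (i + t)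
  f[i]+t≤f[i+t] i zero    _ = ≤-reflexive (trans (+-identityʳ (f i)) (cong f (sym (+-identityʳ i))))
  f[i]+t≤f[i+t] i (suc t) i+1+t≤d = begin
    f i + suc t      ≡⟨ +-suc (f i) t ⟩
    suc (f i + t)    ≤⟨ s≤s (f[i]+t≤f[i+t] i t (≤-trans (n≤1+n (i + t)) i+1+t≤d′)) ⟩
    suc (f (i + t))  ≤⟨ unit-step (i + t) i+1+t≤d′ ⟩
    f (suc (i + t))  ≡⟨ cong f (sym (+-suc i t)) ⟩
    f (i + suc t)    ∎
    where
    open ≤-Reasoning
    i+1+t≤d′ : suc (i + t) ≤ d
    i+1+t≤d′ = subst (_≤ d) (+-suc i t) i+1+t≤d

  f[j]≡j : f 0 ≡ 0 → f d ≡ d → ∀ j → j ≤ d → f j ≡ j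
  f[j]≡j f0≡0 fd≡d j j≤d = ≤-antisym f[j]≤j j≤f[j]
    where
    j≤f[j] : j ≤ f j
    j≤f[j] = subst (_≤ f j) (cong (_+ j) f0≡0) (f[i]+t≤f[i+t] 0 j j≤d)
    d-gap : j + (d ∸ j) ≡ d
    d-gap = m+[n∸m]≡n j≤d
    f[j]≤j : f j ≤ j
    f[j]≤j = +-cancelʳ-≤ (d ∸ j) (f j) j (begin
      f j + (d ∸ j)    ≤⟨ f[i]+t≤f[i+t] j (d ∸ j) (≤-reflexive d-gap) ⟩
      f (j + (d ∸ j))  ≡⟨ trans (cong f d-gap) (trans fd≡d (sym d-gap)) ⟩
      j + (d ∸ j)      ∎)
      where open ≤-Reasoning

Reach-map : ∀ {m n} {F : Fin m → Fin m → Set} {F′ : Fin n → Fin n → Set} (f : Fin m → Fin n) →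
  (∀ {x y} → F x y → F′ (f x) (f y)) → ∀ {x y} → Reach F x y → Reach F′ (f x) (f y)
Reach-map f f-hom here       = here
Reach-map f f-hom (step e r) = step (f-hom e) (Reach-map f f-hom r)

Reach-snoc : ∀ {n} {F : Fin n → Fin n → Set} {x y z} → Reach F x y → F y z → Reach F x z
Reach-snoc here       e = step e here
Reach-snoc (step e r) e′ = step e (Reach-snoc r e′)

Reach-sym : ∀ {n} {F : Fin n → Fin n → Set} → (∀ {x y} → F x y → F y x) →
  ∀ {x y} → Reach F x y → Reach F y x
Reach-sym F-sym here       = here
Reach-sym F-sym (step e r) = Reach-snoc (Reach-sym F-sym r) (F-sym e)

Cycle-map : ∀ {m n} {F : Fin m → Fin m → Set} {F′ : Fin n → Fin n → Set} (f : Fin m → Fin n) →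
  (∀ {x y} → f x ≡ f y → x ≡ y) → (∀ {x y} → F x y → F′ (f x) (f y)) → Cycle F → Cycle F′
Cycle-map f f-inj f-hom (l , c , c-inj , cons , close) =
  l , f ∘ c , c-inj ∘ f-inj , (λ i j j≡1+i → f-hom (cons i j j≡1+i)) , f-hom close

module _ {n l} {F : Fin n → Fin n → Set} {c : Fin (3 + l) → Fin n}
         (cons : ∀ i j → toℕ j ≡ suc (toℕ i) → F (c i) (c j))
         (close : F (c (fromℕ (2 + l))) (c zero)) where

  cycle-neighbours : ∀ i → ∃₂ λ a b → a ≢ b × F (c a) (c i) × F (c i) (c b)
  cycle-neighbours zero = fromℕ (2 + l) , suc zero , (λ ()) , close , cons zero (suc zero) refl
  cycle-neighbours (suc j) with j ≟ fromℕ (suc l)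
  ... | yes refl = inject₁ j , zero , (λ ()) ,
                   cons (inject₁ j) (suc j) (cong suc (sym (toℕ-inject₁ j))) , close
  ... | no j≢last = inject₁ j , suc (suc j↓) , a≢b ,
                    cons (inject₁ j) (suc j) (cong suc (sym (toℕ-inject₁ j))) ,
                    cons (suc j) (suc (suc j↓)) (cong (λ t → suc (suc t)) (toℕ-lower₁ j l≢j))
    where
    l≢j : suc l ≢ toℕ j
    l≢j l≡j = j≢last (toℕ-injective (trans (sym l≡j) (sym (toℕ-fromℕ (suc l)))))
    j↓ : Fin (suc l)
    j↓ = lower₁ j l≢j
    a≢b : inject₁ j ≢ suc (suc j↓)
    a≢b eq = m≢1+n+m (toℕ j) {1}
      (trans (sym (toℕ-inject₁ j)) (trans (cong toℕ eq) (cong (λ t → suc (suc t)) (toℕ-lower₁ j l≢j))))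

module _ {n} {F : Fin (suc n) → Fin (suc n) → Set} (v : Fin (suc n))
         (F-sym : ∀ {a b} → F a b → F b a) (leaf : ∀ {a b} → F a v → F b v → a ≡ b) where

  private
    F∖v : Fin n → Fin n → Set
    F∖v a b = F (punchIn v a) (punchIn v b)

  mutual
    Reach-avoid-leaf : ∀ {x y} → Reach F x y → ∀ {x′ y′} →
      punchIn v x′ ≡ x → punchIn v y′ ≡ y → Reach F∖v x′ y′
    Reach-avoid-leaf here {x′} refl y′↑≡x′↑ =
      subst (Reach F∖v x′) (punchIn-injective v _ _ (sym y′↑≡x′↑)) here
    Reach-avoid-leaf (step {y = z} e r) refl y′↑≡y with v ≟ z
    ... | yes refl = Reach-from-leaf r e y′↑≡y
    ... | no v≢z   = step (subst (F _) (sym (punchIn-punchOut v≢z)) e)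
                          (Reach-avoid-leaf r (punchIn-punchOut v≢z) y′↑≡y)

    -- A walk leaving v must return through the only neighbour of v, which
    -- we then start from instead.
    Reach-from-leaf : ∀ {y} → Reach F v y → ∀ {a y′} →
      F (punchIn v a) v → punchIn v y′ ≡ y → Reach F∖v a y′
    Reach-from-leaf here               a—v y′↑≡v = ⊥-elim (punchInᵢ≢i v _ y′↑≡v)
    Reach-from-leaf (step {y = z} e r) a—v y′↑≡y with v ≟ z
    ... | yes refl = Reach-from-leaf r a—v y′↑≡y
    ... | no _     = Reach-avoid-leaf r (leaf a—v (F-sym e)) y′↑≡y

  Cycle-avoid-leaf : Cycle F → Cycle F∖v
  Cycle-avoid-leaf (l , c , c-inj , cons , close) with any? (λ i → c i ≟ v)
  ... | yes (i , cᵢ≡v) with cycle-neighbours {F = F} {c = c} cons close i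
  ...   | a , b , a≢b , a—cᵢ , cᵢ—b =
    ⊥-elim (a≢b (c-inj (leaf (subst (F (c a)) cᵢ≡v a—cᵢ) (subst (F (c b)) cᵢ≡v (F-sym cᵢ—b)))))
  Cycle-avoid-leaf (l , c , c-inj , cons , close) | no v∉c =
    l , c′ , c′-inj , (λ i j j≡1+i → lower (cons i j j≡1+i)) , lower close
    where
    c≢v : ∀ i → v ≢ c i
    c≢v i v≡cᵢ = v∉c (i , sym v≡cᵢ)
    c′ : Fin (3 + l) → Fin n
    c′ i = punchOut (c≢v i)
    lower : ∀ {i j} → F (c i) (c j) → F∖v (c′ i) (c′ j)
    lower {i} {j} = subst₂ F (sym (punchIn-punchOut (c≢v i))) (sym (punchIn-punchOut (c≢v j)))
    c′-inj : ∀ {i j} → c′ i ≡ c′ j → i ≡ j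
    c′-inj {i} {j} c′ᵢ≡c′ⱼ =
      c-inj (trans (sym (punchIn-punchOut (c≢v i)))
                   (trans (cong (punchIn v) c′ᵢ≡c′ⱼ) (punchIn-punchOut (c≢v j))))

data PunchInView {n} (v : Fin (suc n)) : Fin (suc n) → Set where
  at : PunchInView v v
  ↑_ : (x : Fin n) → PunchInView v (punchIn v x)

punchIn-view : ∀ {n} (v x : Fin (suc n)) → PunchInView v x
punchIn-view v x with v ≟ x
... | yes refl = at
... | no v≢x   = subst (PunchInView v) (punchIn-punchOut v≢x) (↑ punchOut v≢x)

module _ {n} (G : EdgeLabeledGraph n) where

  adj⇒≢ : ∀ {x y} → adj G x y ≡ true → x ≢ y
  adj⇒≢ {x} x—x refl with trans (sym x—x) (adj-irr G x)
  ... | ()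

  inπ-sym : ∀ {k x y} → inπ G k x y → inπ G k y x
  inπ-sym {x = x} {y} (x—y , xy≡k) = trans (adj-sym G y x) x—y , trans (sym (lab-sym G x y x—y)) xy≡k

  inE-sym : ∀ {k x y} → inE G k x y → inE G k y x
  inE-sym {x = x} {y} (x—y , xy≤k) = trans (adj-sym G y x) x—y , subst (_≤ _) (lab-sym G x y x—y) xy≤k

  inEᵇ⇒inE : ∀ {k x y} → inEᵇ G k x y ≡ true → inE G k x y
  inEᵇ⇒inE {k} {x} {y} xyᵇ with adj G x y
  ... | true = refl , ≤ᵇ⇒≤ (lab G x y) k (Equivalence.from T-≡ xyᵇ)

  inE⇒inEᵇ : ∀ {k x y} → inE G k x y → inEᵇ G k x y ≡ true
  inE⇒inEᵇ (x—y , xy≤k) rewrite x—y = Equivalence.to T-≡ (≤⇒≤ᵇ xy≤k)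

  commonᵇ : ℕ → Fin n → Fin n → Fin n → Bool
  commonᵇ k u w′ w = inEᵇ G k u w ∧ inEᵇ G k w′ w

module _ {m} (G : EdgeLabeledGraph (suc m)) (v : Fin (suc m)) (simp : IsMATSimplicial G v) where

  private
    d : ℕ
    d = degree G v

    clique : MS1 G v
    clique = proj₁ simp

    label≤degree : ∀ u → adj G u v ≡ true → lab G u v ≤ d
    label≤degree u u—v = proj₂ (proj₁ (proj₁ (proj₂ simp)) u u—v)

    label-onto : ∀ k → 1 ≤ k → k ≤ d → ∃ λ u → adj G u v ≡ true × lab G u v ≡ k
    label-onto = proj₂ (proj₁ (proj₂ simp))

    clique-labels : MS3 G v
    clique-labels = proj₂ (proj₂ simp)

    N≤ : ℕ → Fin (suc m) → Bool
    N≤ j u = inEᵇ G j u v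

    N≡ : ℕ → Fin (suc m) → Bool
    N≡ j u = N≤ (suc j) u ∧ not (N≤ j u)

  lower-label-edge : ∀ {x y} → adj G x v ≡ true → adj G y v ≡ true → lab G y v < lab G x v →
    adj G x y ≡ true × lab G x y < lab G x v
  lower-label-edge {x} {y} x—v y—v yv<xv =
    clique x y x—v y—v x≢y ,
    subst (lab G x y <_) (m≥n⇒m⊔n≡m (<⇒≤ yv<xv)) (clique-labels x y x—v y—v x≢y)
    where
    x≢y : x ≢ y
    x≢y refl = <-irrefl refl yv<xv

  inπ-inE-adjacent : ∀ {j x y} → inπ G (suc j) x v → inE G j y v → inE G j x y
  inπ-inE-adjacent {j} {x} {y} (x—v , xv≡1+j) (y—v , yv≤j)
    with lower-label-edge x—v y—v (subst (lab G y v <_) (sym xv≡1+j) (s≤s yv≤j))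
  ... | x—y , xy<xv = x—y , ≤-pred (subst (lab G x y <_) xv≡1+j xy<xv)

  private
    #N≤-suc : ∀ j → count (N≤ (suc j)) ≡ count (N≤ j) + count (N≡ j)
    #N≤-suc j = count-split-⊆ (N≤ (suc j)) (N≤ j)
      (λ u → inE⇒inEᵇ G ∘ map₂ (λ uv≤j → ≤-trans uv≤j (n≤1+n j)) ∘ inEᵇ⇒inE G)

    N≡-true : ∀ {j u} → inπ G (suc j) u v → N≡ j u ≡ true
    N≡-true {j} (u—v , uv≡1+j) =
      cong₂ _∧_ (inE⇒inEᵇ G (u—v , ≤-reflexive uv≡1+j)) (cong not (¬-not uv≰j))
      where
      uv≰j : N≤ j _ ≢ true
      uv≰j uv≤jᵇ = 1+n≰n (subst (_≤ j) uv≡1+j (proj₂ (inEᵇ⇒inE G uv≤jᵇ)))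

    #N≤-step : ∀ j → j < d → suc (count (N≤ j)) ≤ count (N≤ (suc j))
    #N≤-step j j<d with label-onto (suc j) (s≤s z≤n) j<d
    ... | u , u∈π = begin
      suc (count (N≤ j))             ≡⟨ +-comm 1 (count (N≤ j)) ⟩
      count (N≤ j) + 1               ≤⟨ +-monoʳ-≤ (count (N≤ j)) (1≤count (N≡ j) (N≡-true u∈π)) ⟩
      count (N≤ j) + count (N≡ j)    ≡⟨ sym (#N≤-suc j) ⟩
      count (N≤ (suc j))             ∎
      where open ≤-Reasoning

    #N≤-zero : count (N≤ 0) ≡ 0
    #N≤-zero = count-all-false (N≤ 0) λ u → ¬-not λ uv≤0ᵇ →
      let (u—v , uv≤0) = inEᵇ⇒inE G uv≤0ᵇ in 1+n≰n (≤-trans (lab-pos G u v u—v) uv≤0)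

    #N≤-degree : count (N≤ d) ≡ d
    #N≤-degree = count-cong λ u →
      ≡true-ext (proj₁ ∘ inEᵇ⇒inE G) (λ u—v → inE⇒inEᵇ G (u—v , label≤degree u u—v))

  #N≤≡ : ∀ j → j ≤ d → count (N≤ j) ≡ j
  #N≤≡ = f[j]≡j {f = λ j → count (N≤ j)} #N≤-step #N≤-zero #N≤-degree

  nbr-label-injective : ∀ {k a b} → inπ G k a v → inπ G k b v → a ≡ b
  nbr-label-injective {zero} (a—v , av≡0) _ =
    ⊥-elim (1+n≰n (subst (1 ≤_) av≡0 (lab-pos G _ v a—v)))
  nbr-label-injective {suc j} {a} {b} a∈π b∈π with a ≟ b
  ... | yes a≡b = a≡b
  ... | no a≢b  = ⊥-elim (1+n≰n (begin
    suc (suc j)                    ≡⟨ +-comm 2 j ⟩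
    j + 2                          ≤⟨ +-monoʳ-≤ j (2≤count (N≡ j) a≢b (N≡-true a∈π) (N≡-true b∈π)) ⟩
    j + count (N≡ j)               ≡⟨ cong (_+ count (N≡ j)) (sym (#N≤≡ j (≤-trans (n≤1+n j) 1+j≤d))) ⟩
    count (N≤ j) + count (N≡ j)    ≡⟨ sym (#N≤-suc j) ⟩
    count (N≤ (suc j))             ≡⟨ #N≤≡ (suc j) 1+j≤d ⟩
    suc j                          ∎))
    where
    open ≤-Reasoning
    1+j≤d : suc j ≤ d
    1+j≤d = subst (_≤ d) (proj₂ a∈π) (label≤degree a (proj₁ a∈π))

  inπ⇒v∉common : ∀ {j x y} → inπ G (suc j) x y → commonᵇ G j x y v ≡ false
  inπ⇒v∉common {j} {x} {y} (x—y , xy≡1+j) = ¬-not λ bothᵇ →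
    let (x—v , xv≤j) = inEᵇ⇒inE G (∧-conicalˡ (inEᵇ G j x v) (inEᵇ G j y v) bothᵇ)
        (y—v , yv≤j) = inEᵇ⇒inE G (∧-conicalʳ (inEᵇ G j x v) (inEᵇ G j y v) bothᵇ)
    in 1+n≰n (begin
      suc j                      ≡⟨ sym xy≡1+j ⟩
      lab G x y                  <⟨ clique-labels x y x—v y—v (adj⇒≢ G x—y) ⟩
      lab G x v ⊔ lab G y v      ≤⟨ ⊔-lub xv≤j yv≤j ⟩
      j                          ∎)
    where open ≤-Reasoning

  #common-v : ∀ {j w′} → inπ G (suc j) w′ v → count (commonᵇ G j v w′) ≡ j
  #common-v {j} {w′} w′∈π = trans (count-cong common≗N≤) (#N≤≡ j j≤d)
    where
    j≤d : j ≤ d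
    j≤d = ≤-trans (n≤1+n j) (subst (_≤ d) (proj₂ w′∈π) (label≤degree w′ (proj₁ w′∈π)))
    common≗N≤ : ∀ w → commonᵇ G j v w′ w ≡ N≤ j w
    common≗N≤ w = ≡true-ext
      (λ common → inE⇒inEᵇ G (inE-sym G (inEᵇ⇒inE G (∧-conicalˡ (inEᵇ G j v w) (inEᵇ G j w′ w) common))))
      (λ wv≤jᵇ → let wv≤j = inEᵇ⇒inE G wv≤jᵇ in
        cong₂ _∧_ (inE⇒inEᵇ G (inE-sym G wv≤j)) (inE⇒inEᵇ G (inπ-inE-adjacent w′∈π wv≤j)))

  deleteVertex-preserves-MAT : IsMATLabeling G → IsMATLabeling (deleteVertex G v)
  deleteVertex-preserves-MAT mat (suc j) 1≤k with mat (suc j) 1≤k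
  ... | forest , closed , common = forest∖v , closed∖v , common∖v
    where
    G∖v = deleteVertex G v

    forest∖v : ML1 G∖v (suc j)
    forest∖v = forest ∘ Cycle-map {F = inπ G∖v (suc j)} {F′ = inπ G (suc j)}
                          (punchIn v) (punchIn-injective v _ _) (λ e → e)

    closed∖v : ML2 G∖v (suc j)
    closed∖v x y (x—y , r) =
      closed (punchIn v x) (punchIn v y)
        (x—y , Reach-map {F = inπ G∖v (suc j)} {F′ = inπ G (suc j)} (punchIn v) (λ e → e) r)

    common∖v : ML3 G∖v (suc j)
    common∖v u w′ uw′∈π =
      trans (sym (count-punchIn-false v {commonᵇ G j (punchIn v u) (punchIn v w′)} (inπ⇒v∉common uw′∈π)))
            (common (punchIn v u) (punchIn v w′) uw′∈π)

  deleteVertex-reflects-MAT : IsMATLabeling (deleteVertex G v) → IsMATLabeling G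
  deleteVertex-reflects-MAT mat (suc j) 1≤k with mat (suc j) 1≤k
  ... | forest , closed , common = forest⁺ , closed⁺ , common⁺
    where
    G∖v = deleteVertex G v

    π = inπ G (suc j)

    forest⁺ : ML1 G (suc j)
    forest⁺ = forest ∘ Cycle-avoid-leaf {F = π} v (inπ-sym G) nbr-label-injective

    avoid : ∀ {x y} → Reach π (punchIn v x) (punchIn v y) → Reach (inπ G∖v (suc j)) x y
    avoid r = Reach-avoid-leaf {F = π} v (inπ-sym G) nbr-label-injective r refl refl

    ¬closed-from-v : ∀ {y} → inE G j v y → ¬ Reach π v y
    ¬closed-from-v (v—v , _) here = adj⇒≢ G v—v refl
    ¬closed-from-v {y} vy∈E (step {y = z} v—z r) with punchIn-view v z | punchIn-view v y
    ... | at   | _    = adj⇒≢ G (proj₁ v—z) refl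
    ... | ↑ _  | at   = adj⇒≢ G (proj₁ vy∈E) refl
    ... | ↑ z′ | ↑ y′ = closed z′ y′ (proj₁ zy∈E , avoid r) zy∈E
      where
      zy∈E = inπ-inE-adjacent (inπ-sym G v—z) (inE-sym G vy∈E)

    closed⁺ : ML2 G (suc j)
    closed⁺ x y (x—y , r) xy∈E with punchIn-view v x | punchIn-view v y
    ... | at   | _    = ¬closed-from-v xy∈E r
    ... | ↑ _  | at   = ¬closed-from-v (inE-sym G xy∈E) (Reach-sym (inπ-sym G) r)
    ... | ↑ x′ | ↑ y′ = closed x′ y′ (x—y , avoid r) xy∈E

    common⁺ : ML3 G (suc j)
    common⁺ u w′ uw′∈π with punchIn-view v u | punchIn-view v w′
    ... | at   | _    = #common-v (inπ-sym G uw′∈π)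
    ... | ↑ _  | at   =
      trans (count-cong (λ w → ∧-comm (inEᵇ G j u w) (inEᵇ G j v w))) (#common-v uw′∈π)
    ... | ↑ u″ | ↑ w″ =
      trans (count-punchIn-false v {commonᵇ G j u w′} (inπ⇒v∉common uw′∈π)) (common u″ w″ uw′∈π)

proposition5p3 : (m : ℕ) → 1 ≤ m → (G : EdgeLabeledGraph (suc m)) → (v : Fin (suc m)) →
    IsMATSimplicial G v → (IsMATLabeling G ⇔ IsMATLabeling (deleteVertex G v))
proposition5p3 m _ G v simp =
  mk⇔ (deleteVertex-preserves-MAT G v simp) (deleteVertex-reflects-MAT G v simp)
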